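{- For every one-hole context $\Theta\{\}$ and every structure $\Xi$, we have $(\overline{\Theta\{*\}},\Xi)\sim\Theta\{\Xi\}$.
   Context: Structures over formulas: $\Gamma::=\varnothing\mid F\mid(\Gamma,\Gamma)$, identified modulo $(\varnothing,\Gamma)=(\Gamma,\varnothing)=\Gamma$; $\equiv$ denotes syntactic identity of structures (modulo this identification). A one-hole context $\Theta\{\}$ is a structure with one leaf replaced by a hole; $\Theta\{\Delta\}$ is the result of filling the hole with $\Delta$, and $\Theta\{*\}$ treats the hole as a special leaf $*$. Structural equivalence $\sim$ is the reflexive, symmetric, transitive closure of the relations $(\Gamma,\Delta)\sim(\Delta,\Gamma)$ and $(\Gamma,(\Delta,\Pi))\sim((\Gamma,\Delta),\Pi)$ applied to the whole structure (top level only, not inside substructures). The designated structure $\overline{\Theta\{*\}}$ of a context is defined recursively: $\overline{(R\{*\},\Delta)}:=\overline{(\Delta,R\{*\})}$ (hole in left component); $\overline{(\Gamma,(\Delta,P\{*\}))}:=\overline{((\Gamma,\Delta),P\{*\})}$; $\overline{(\Gamma,(D\{*\},\Pi))}:=\overline{((\Pi,\Gamma),D\{*\})}$; $\overline{(\Gamma,*)}:=\Gamma$; $\overline{*}:=\varnothing$. -}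

module Defs where

-- Structures over formulas of an arbitrary type A, represented in the
-- canonical form modulo (∅,Γ) = (Γ,∅) = Γ : either empty, or a nonempty
-- binary tree of formulas (no ∅ leaves inside).

data NE (A : Set) : Set where
  leaf : A → NE A
  node : NE A → NE A → NE A

data Str (A : Set) : Set where
  ∅  : Str A
  ne : NE A → Str A

fml : {A : Set} → A → Str A
fml F = ne (leaf F)

infixr 5 _,ₛ_
_,ₛ_ : {A : Set} → Str A → Str A → Str A
∅    ,ₛ Δ    = Δ
ne Γ ,ₛ ∅    = ne Γ
ne Γ ,ₛ ne Δ = ne (node Γ Δ)

-- One-hole contexts (canonical form modulo units): the hole *, or a pair
-- with the hole in the left / right component and a nonempty other component.
data Ctx (A : Set) : Set where
  hole  : Ctx A
  left  : Ctx A → NE A → Ctx A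
  right : NE A → Ctx A → Ctx A

plug : {A : Set} → Ctx A → Str A → Str A
plug hole        Ξ = Ξ
plug (left C Δ)  Ξ = plug C Ξ ,ₛ ne Δ
plug (right Γ C) Ξ = ne Γ ,ₛ plug C Ξ

-- over Γ P = designated structure of (Γ, P{*}), by the recursive clauses
--   (Γ,*)             ↦ Γ
--   (Γ,(Δ,P{*}))      ↦ ((Γ,Δ),P{*})
--   (Γ,(D{*},Π))      ↦ ((Π,Γ),D{*})
over : {A : Set} → Str A → Ctx A → Str A
over Γ hole        = Γ
over Γ (right Δ P) = over (Γ ,ₛ ne Δ) P
over Γ (left D Π)  = over (ne Π ,ₛ Γ) D

designated : {A : Set} → Ctx A → Str A
designated hole        = ∅
designated (left R Δ)  = over (ne Δ) R
designated (right Γ P) = over (ne Γ) P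

-- Structural equivalence: reflexive, symmetric, transitive closure of
-- commutativity and associativity applied at top level only.
infix 4 _∼_
data _∼_ {A : Set} : Str A → Str A → Set where
  ∼-comm  : (Γ Δ : Str A) → (Γ ,ₛ Δ) ∼ (Δ ,ₛ Γ)
  ∼-assoc : (Γ Δ Π : Str A) → (Γ ,ₛ (Δ ,ₛ Π)) ∼ ((Γ ,ₛ Δ) ,ₛ Π)
  ∼-refl  : {Γ : Str A} → Γ ∼ Γ
  ∼-sym   : {Γ Δ : Str A} → Γ ∼ Δ → Δ ∼ Γ
  ∼-trans : {Γ Δ Π : Str A} → Γ ∼ Δ → Δ ∼ Π → Γ ∼ Π

{-# OPTIONS --safe #-}
module Submission where

open import Relation.Binary.Bundles using (Setoid)
open import Relation.Binary.Structures using (IsEquivalence)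
import Relation.Binary.Reasoning.Setoid as SetoidReasoning

open import Defs

-- Each step of over only reassociates or rotates the accumulated structure,
-- so once the hole is filled it is undone by the top-level laws of ∼.

∼-isEquivalence : {A : Set} → IsEquivalence (_∼_ {A})
∼-isEquivalence = record { refl = ∼-refl ; sym = ∼-sym ; trans = ∼-trans }

∼-setoid : Set → Setoid _ _
∼-setoid A = record { Carrier = Str A ; _≈_ = _∼_ ; isEquivalence = ∼-isEquivalence }

over-,ₛ : {A : Set} (Γ : Str A) (P : Ctx A) (Ξ : Str A) →
          (over Γ P ,ₛ Ξ) ∼ (Γ ,ₛ plug P Ξ)
over-,ₛ Γ hole        Ξ = ∼-refl
over-,ₛ Γ (right Δ P) Ξ = begin
  over (Γ ,ₛ ne Δ) P ,ₛ Ξ    ≈⟨ over-,ₛ (Γ ,ₛ ne Δ) P Ξ ⟩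
  (Γ ,ₛ ne Δ) ,ₛ plug P Ξ    ≈⟨ ∼-sym (∼-assoc Γ (ne Δ) (plug P Ξ)) ⟩
  Γ ,ₛ (ne Δ ,ₛ plug P Ξ)    ∎
  where open SetoidReasoning (∼-setoid _)
over-,ₛ Γ (left D Π)  Ξ = begin
  over (ne Π ,ₛ Γ) D ,ₛ Ξ    ≈⟨ over-,ₛ (ne Π ,ₛ Γ) D Ξ ⟩
  (ne Π ,ₛ Γ) ,ₛ plug D Ξ    ≈⟨ ∼-sym (∼-assoc (ne Π) Γ (plug D Ξ)) ⟩
  ne Π ,ₛ (Γ ,ₛ plug D Ξ)    ≈⟨ ∼-comm (ne Π) (Γ ,ₛ plug D Ξ) ⟩
  (Γ ,ₛ plug D Ξ) ,ₛ ne Π    ≈⟨ ∼-sym (∼-assoc Γ (plug D Ξ) (ne Π)) ⟩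
  Γ ,ₛ (plug D Ξ ,ₛ ne Π)    ∎
  where open SetoidReasoning (∼-setoid _)

lemma2p1 : {A : Set} (Θ : Ctx A) (Ξ : Str A) → (designated Θ ,ₛ Ξ) ∼ plug Θ Ξ
lemma2p1 hole        Ξ = ∼-refl
lemma2p1 (left R Δ)  Ξ = ∼-trans (over-,ₛ (ne Δ) R Ξ) (∼-comm (ne Δ) (plug R Ξ))
lemma2p1 (right Γ P) Ξ = over-,ₛ (ne Γ) P Ξ
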